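{- Let $I\subseteq\mathrm{Ch}$. There exists a CFM $\mathcal A_1$ (with $0$ labeling bits) of index $1$ with three local states per process and one message that accepts an MSC $M$ iff $\mathrm{Inf}(M)\subseteq I$.
   Context: Fix a finite set $\mathcal P$ of processes, $\mathrm{Ch}=\{(p,q)\in\mathcal P^2:p\ne q\}$, $\Sigma_p=\{p!q,p?q:q\ne p\}$, $\Sigma=\bigcup_p\Sigma_p$. For a $\Sigma$-labeled poset $(V,\le,\lambda)$, $P(v)=p$ iff $\lambda(v)\in\Sigma_p$, $V_p=P^{ -1}(p)$; $(v,v')\in\mathrm{proc}$ iff $P(v)=P(v')$, $v<v'$, no node of that process strictly between; $(v,v')\in\mathrm{msg}$ iff for some $(p,q)\in\mathrm{Ch}$, $\lambda(v)=p!q$, $\lambda(v')=q?p$ and $|\{u\le v:\lambda(u)=p!q\}|=|\{u\le v':\lambda(u)=q?p\}|$. An MSC is such a structure with $\le=(\mathrm{proc}\cup\mathrm{msg})^*$, all down-sets finite, each $V_p$ linearly ordered, $|\lambda^{ -1}(p!q)|=|\lambda^{ -1}(q?p)|$ for all channels. $\mathrm{Inf}(M)=\{(p,q)\in\mathrm{Ch}:\lambda^{ -1}(p!q)$ is infinite$\}$. A CFM is $\mathcal A=(C,k,(\mathcal A_p)_p,F)$ with finite message set $C$, $\mathcal A_p=(S_p,\to_p,\iota_p)$ ($S_p$ finite set of local states, $\to_p\subseteq S_p\times(\Sigma_p\times\{0,1\}^k\times C)\times S_p$), $F\subseteq\prod_pS_p$. A run on $(M,c)$, $c:V\to\{0,1\}^k$,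 is $(\rho,\mu)$ with $\mu(v)=\mu(\mathrm{msg}(v))$ when defined and $(\rho(\mathrm{proc}^{ -1}(v)),\lambda(v),c(v),\mu(v),\rho(v))\in\to_{P(v)}$ (with $\iota_{P(v)}$ if $v$ is minimal on its process); accepting if some $(s_p)\in F$ has $s_p\in\{s:\forall v\in V_p\exists v'\in V_p,v\le v',\rho(v')=s\}$ for all $p$. The index of a CFM is the least $r$ with $F=\bigcup_{i=1}^r\prod_pF^i_p$ for some $F^i_p\subseteq S_p$. -}

module Defs where

open import Level using (0ℓ)
open import Data.Nat using (ℕ; _<_)
open import Data.Fin using (Fin)
open import Data.Bool using (Bool; true; false)
open import Data.Vec using (Vec)
open import Data.Product using (Σ; ∃; _×_; _,_; proj₁; proj₂)
open import Data.Sum using (_⊎_)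
open import Data.Empty using (⊥)
open import Relation.Nullary using (¬_)
open import Relation.Binary.PropositionalEquality using (_≡_; _≢_; subst)
open import Relation.Binary.Construct.Closure.ReflexiveTransitive using (Star)
open import Function.Definitions using (Injective)

infix 2 _⟺_
_⟺_ : Set → Set → Set
A ⟺ B = (A → B) × (B → A)

HasSize : {V : Set} → (V → Set) → ℕ → Set
HasSize {V} S k =
  Σ (Fin k → V) λ f → Injective _≡_ _≡_ f × (∀ v → S v ⟺ (∃ λ i → f i ≡ v))

Finite : {V : Set} → (V → Set) → Set
Finite S = ∃ λ k → HasSize S k

Infinite : {V : Set} → (V → Set) → Set
Infinite S = ¬ Finite S

-- Actions.  The processes are 𝒫 = Fin n.
-- lab p q snd  stands for  p!q ,   lab p q rcv  stands for  p?q.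
-- (Validity p ≢ q is imposed in the MSC structure.)

data Dir : Set where
  snd rcv : Dir

record Label (n : ℕ) : Set where
  constructor lab
  field
    proc    : Fin n
    partner : Fin n
    dir     : Dir

open Label public

record PreMSC (n : ℕ) : Set₁ where
  field
    V   : Set
    _≤_ : V → V → Set
    lbl : V → Label n

module _ {n : ℕ} (M : PreMSC n) where
  open PreMSC M

  Pr : V → Fin n
  Pr v = proc (lbl v)

  _<ᵥ_ : V → V → Set
  u <ᵥ v = u ≤ v × u ≢ v

  ProcEdge : V → V → Set
  ProcEdge u v = Pr u ≡ Pr v × u <ᵥ v × (∀ w → Pr w ≡ Pr u → u <ᵥ w → w <ᵥ v → ⊥)

  MsgEdge : V → V → Set
  MsgEdge u v =
    Σ (Fin n) λ p → Σ (Fin n) λ q → p ≢ q ×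
      lbl u ≡ lab p q snd × lbl v ≡ lab q p rcv ×
      (Σ ℕ λ k → HasSize (λ w → w ≤ u × lbl w ≡ lab p q snd) k
               × HasSize (λ w → w ≤ v × lbl w ≡ lab q p rcv) k)

  Edge : V → V → Set
  Edge u v = ProcEdge u v ⊎ MsgEdge u v

  record IsMSC : Set where
    field
      ≤-refl    : ∀ v → v ≤ v
      ≤-trans   : ∀ u v w → u ≤ v → v ≤ w → u ≤ w
      ≤-antisym : ∀ u v → u ≤ v → v ≤ u → u ≡ v
      lbl-valid : ∀ v → proc (lbl v) ≢ partner (lbl v)
      ≤-generated : ∀ u v → u ≤ v ⟺ Star Edge u v
      downFinite  : ∀ v → Finite (λ u → u ≤ v)
      procLinear  : ∀ u v → Pr u ≡ Pr v → u ≤ v ⊎ v ≤ u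
      channelBalanced : ∀ p q → p ≢ q → ∀ k →
        HasSize (λ w → lbl w ≡ lab p q snd) k ⟺ HasSize (λ w → lbl w ≡ lab q p rcv) k

record MSC (n : ℕ) : Set₁ where
  field
    pre   : PreMSC n
    isMSC : IsMSC pre
  open PreMSC pre public

InfSubset : {n : ℕ} → MSC n → (Fin n → Fin n → Bool) → Set
InfSubset {n} M I =
  ∀ (p q : Fin n) → p ≢ q →
    Infinite (λ w → MSC.lbl M w ≡ lab p q snd) → I p q ≡ true

-- Local states of p: Fin (nStates p);  messages C = Fin nMsg;
-- labelling bits {0,1}^k = Vec Bool k.  The transition relation
-- ⊆ S_p × (Σ_p × {0,1}^k × C) × S_p is given by its characteristic
-- function; an action of Σ_p is given by its partner and direction.

record CFM (n : ℕ) : Set where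
  field
    nMsg    : ℕ
    k       : ℕ
    nStates : Fin n → ℕ
    init    : (p : Fin n) → Fin (nStates p)
    δ       : (p : Fin n) → Fin (nStates p) → Fin n → Dir → Vec Bool k →
              Fin nMsg → Fin (nStates p) → Bool
    F       : ((p : Fin n) → Fin (nStates p)) → Bool

module _ {n : ℕ} (A : CFM n) where
  open CFM A

  St : Fin n → Set
  St p = Fin (nStates p)

  UnionOfProducts : ℕ → Set
  UnionOfProducts r =
    Σ (Fin r → (p : Fin n) → St p → Bool) λ Fi →
      ∀ (s : (p : Fin n) → St p) →
        (F s ≡ true) ⟺ (∃ λ i → ∀ p → Fi i p (s p) ≡ true)

  HasIndex : ℕ → Set
  HasIndex r = UnionOfProducts r × (∀ r' → r' < r → ¬ UnionOfProducts r')

  module _ (M : MSC n) where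
    open MSC M

    record Run (c : V → Vec Bool k) : Set where
      field
        ρ : (v : V) → St (Pr pre v)
        μ : V → Fin nMsg
        msgOk : ∀ u v → MsgEdge pre u v → μ u ≡ μ v
        stepProc : ∀ u v (e : ProcEdge pre u v) →
          δ (Pr pre v) (subst St (proj₁ e) (ρ u))
            (partner (lbl v)) (dir (lbl v)) (c v) (μ v) (ρ v) ≡ true
        stepInit : ∀ v → (∀ u → Pr pre u ≡ Pr pre v → _<ᵥ_ pre u v → ⊥) →
          δ (Pr pre v) (init (Pr pre v))
            (partner (lbl v)) (dir (lbl v)) (c v) (μ v) (ρ v) ≡ true

    Recurring : ((v : V) → St (Pr pre v)) → (p : Fin n) → St p → Set
    Recurring ρ p s =
      ∀ v → Pr pre v ≡ p →
        Σ V λ v' → Σ (Pr pre v' ≡ p) λ e → v ≤ v' × subst St e (ρ v') ≡ s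

    AcceptingRun : (c : V → Vec Bool k) → Run c → Set
    AcceptingRun c r =
      Σ ((p : Fin n) → St p) λ s → F s ≡ true × (∀ p → Recurring (Run.ρ r) p (s p))

    Accepts : Set
    Accepts = Σ (V → Vec Bool k) λ c → Σ (Run c) λ r → AcceptingRun c r

module Submission where

-- Each process starts in state idle and may at any moment guess that it has
-- made its last send on a channel outside I and move to final, where such
-- sends are refused; acceptance means every process is eventually in final.
-- If Inf(M) ⊆ I, a process has only finitely many sends outside I, so it can
-- switch right after the last of them (a maximum over a finite set of events
-- of its linear order, found classically).  Conversely, once a process is in
-- final it stays there, so all its sends outside I lie in the finite
-- down-set of the point where it switched.

open import Defs
open import Level using (0ℓ)
open import Axiom.ExcludedMiddle using (ExcludedMiddle)
open import Data.Nat using (ℕ; zero; suc; s≤s; z≤n)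
open import Data.Fin using (Fin; zero; suc; _≟_)
open import Data.Fin.Properties using (all?; ¬Fin0)
open import Data.Bool using (Bool; true; false; if_then_else_)
open import Data.Vec using (Vec; [])
open import Data.Product using (Σ; _×_; _,_; proj₁; proj₂; ∃)
open import Data.Sum using (_⊎_; inj₁; inj₂; swap)
open import Data.Empty using (⊥-elim)
open import Function using (_∘_)
open import Relation.Nullary using (¬_; Dec; yes; no; does; contradiction)
open import Relation.Nullary.Decidable using (dec-true; decidable-stable)
open import Relation.Binary.Definitions using (Reflexive; Transitive)
open import Relation.Binary.PropositionalEquality
  using (_≡_; refl; sym; trans; cong; subst; _≢_)

does-true⇒ : {A : Set} (a? : Dec A) → does a? ≡ true → A
does-true⇒ (yes a) _ = a

subst-const : {A B : Set} {x y : A} (e : x ≡ y) (b : B) → subst (λ _ → B) e b ≡ b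
subst-const refl b = refl

empty-finite : {V : Set} {T : V → Set} → (∀ v → ¬ T v) → Finite T
empty-finite ¬T = 0 , (λ ()) , (λ { {()} }) , λ v → (λ t → ⊥-elim (¬T v t)) , λ { (() , _) }

module Classical (em : ExcludedMiddle 0ℓ) {V : Set} where

  covered⇒finite : ∀ k (f : Fin k → V) (T : V → Set) →
                   (∀ v → T v → ∃ λ i → f i ≡ v) → Finite T
  covered⇒finite zero f T cov = empty-finite λ v t → ¬Fin0 (proj₁ (cov v t))
  covered⇒finite (suc k) f T cov
    with covered⇒finite k (λ i → f (suc i)) (λ v → T v × v ≢ f zero) cov-rest
    where
    cov-rest : ∀ v → T v × v ≢ f zero → ∃ λ i → f (suc i) ≡ v
    cov-rest v (t , v≢f0) with cov v t
    ... | zero  , f0≡v = contradiction (sym f0≡v) v≢f0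
    ... | suc i , fi≡v = i , fi≡v
  ... | m , g , g-inj , g-enum with em {T (f zero)}
  ... | no ¬Tf0 = m , g , g-inj , λ v →
        (λ t → proj₁ (g-enum v) (t , λ v≡f0 → ¬Tf0 (subst T v≡f0 t))) ,
        (λ gi≡v → proj₁ (proj₂ (g-enum v) gi≡v))
  ... | yes Tf0 = suc m , h , h-inj , λ v → to v , from v
    where
    h : Fin (suc m) → V
    h zero    = f zero
    h (suc j) = g j
    g≢f0 : ∀ j → g j ≢ f zero
    g≢f0 j = proj₂ (proj₂ (g-enum (g j)) (j , refl))
    h-inj : ∀ {x y} → h x ≡ h y → x ≡ y
    h-inj {zero}  {zero}  _  = refl
    h-inj {zero}  {suc j} eq = contradiction (sym eq) (g≢f0 j)
    h-inj {suc i} {zero}  eq = contradiction eq (g≢f0 i)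
    h-inj {suc i} {suc j} eq = cong suc (g-inj eq)
    to : ∀ v → T v → ∃ λ i → h i ≡ v
    to v t with em {v ≡ f zero}
    ... | yes v≡f0 = zero , sym v≡f0
    ... | no v≢f0 with proj₁ (g-enum v) (t , v≢f0)
    ... | j , gj≡v = suc j , gj≡v
    from : ∀ v → (∃ λ i → h i ≡ v) → T v
    from v (zero  , f0≡v) = subst T f0≡v Tf0
    from v (suc j , gj≡v) = proj₁ (proj₂ (g-enum v) (j , gj≡v))

  finite-⊆ : {S T : V → Set} → Finite S → (∀ v → T v → S v) → Finite T
  finite-⊆ {T = T} (k , f , _ , f-enum) T⊆S =
    covered⇒finite k f T λ v t → proj₁ (f-enum v) (T⊆S v t)

  module Bounds (R : V → V → Set) (R-refl : Reflexive R) (R-trans : Transitive R)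
                (Q : V → Set) (R-total : ∀ {x y} → Q x → Q y → R x y ⊎ R y x) where

    UpperBound : (V → Set) → V → V → Set
    UpperBound S a r = Q r × R a r × (∀ v → S v → Q v → R v r)

    enumeration-upper-bound : ∀ k (f : Fin k → V) {a} → Q a →
      Σ V λ r → UpperBound (λ v → ∃ λ i → f i ≡ v) a r
    enumeration-upper-bound zero f {a} Qa = a , Qa , R-refl , λ { v (() , _) _ }
    enumeration-upper-bound (suc k) f Qa
      with enumeration-upper-bound k (λ i → f (suc i)) Qa
    ... | r , Qr , ar , bound with em {Q (f zero)}
    ... | no ¬Qf0 = r , Qr , ar , λ { v (zero , refl) Qv → contradiction Qv ¬Qf0
                                    ; v (suc i , fi≡v) Qv → bound v (i , fi≡v) Qv }
    ... | yes Qf0 with R-total Qr Qf0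
    ... | inj₁ r≤f0 = f zero , Qf0 , R-trans ar r≤f0 ,
          λ { v (zero , refl) _ → R-refl
            ; v (suc i , fi≡v) Qv → R-trans (bound v (i , fi≡v) Qv) r≤f0 }
    ... | inj₂ f0≤r = r , Qr , ar , λ { v (zero , refl) _ → f0≤r
                                      ; v (suc i , fi≡v) Qv → bound v (i , fi≡v) Qv }

    finite-upper-bound : {S : V → Set} → Finite S → ∀ {a} → Q a → Σ V (UpperBound S a)
    finite-upper-bound (k , f , _ , f-enum) Qa with enumeration-upper-bound k f Qa
    ... | r , Qr , ar , bound = r , Qr , ar , λ v Sv → bound v (proj₁ (f-enum v) Sv)

    ⋃-upper-bound : ∀ {m} {S : Fin m → V → Set} → (∀ j → Finite (S j)) → ∀ {a} → Q a →
      Σ V (UpperBound (λ v → ∃ λ j → S j v) a)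
    ⋃-upper-bound {zero} _ {a} Qa = a , Qa , R-refl , λ { v (() , _) _ }
    ⋃-upper-bound {suc m} fin Qa with ⋃-upper-bound (λ j → fin (suc j)) Qa
    ... | r , Qr , ar , bound with finite-upper-bound (fin zero) Qr
    ... | r′ , Qr′ , rr′ , bound′ = r′ , Qr′ , R-trans ar rr′ ,
          λ { v (zero , S₀v) Qv → bound′ v S₀v Qv
            ; v (suc j , Sv) Qv → R-trans (bound v (j , Sv) Qv) rr′ }

module ProcessOrder (em : ExcludedMiddle 0ℓ) {n : ℕ} (M : MSC n) where
  open MSC M
  open IsMSC isMSC
  open Classical em {V}

  P : V → Fin n
  P = Pr pre

  _<_ : V → V → Set
  _<_ = _<ᵥ_ pre

  <-≤-trans : ∀ {u v w} → u < v → v ≤ w → u < w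
  <-≤-trans {u} {v} {w} (u≤v , u≢v) v≤w =
    ≤-trans u v w u≤v v≤w ,
    λ u≡w → u≢v (≤-antisym u v u≤v (subst (v ≤_) (sym u≡w) v≤w))

  same-process-total : ∀ {p u v} → P u ≡ p → P v ≡ p → u ≤ v ⊎ v ≤ u
  same-process-total {u = u} {v} pu pv = procLinear u v (trans pu (sym pv))

  proc-predecessor : ∀ {u w} → P u ≡ P w → u < w → Σ V λ y → u ≤ y × ProcEdge pre y w
  proc-predecessor {u} {w} pu≡pw u<w
    with Latest.finite-upper-bound (downFinite w) (pu≡pw , u<w)
    where
    module Latest = Bounds _≤_ (≤-refl _) (≤-trans _ _ _) (λ z → P z ≡ P w × z < w)
                           (λ Qx Qy → same-process-total (proj₁ Qx) (proj₁ Qy))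
  ... | y , (py , y<w) , u≤y , latest = y , u≤y , py , y<w ,
        λ z pz (y≤z , y≢z) z<w →
          y≢z (≤-antisym y z y≤z (latest z (proj₁ z<w) (trans pz py , z<w)))

  proc-induction : (Φ : V → Set) → (∀ {y x} → ProcEdge pre y x → Φ y → Φ x) →
                   ∀ {u w} → Φ u → P u ≡ P w → u ≤ w → Φ w
  proc-induction Φ step {u} {w} Φu pu≡pw u≤w = decidable-stable em ¬¬Φw
    where
    Counterexample : V → Set
    Counterexample z = P z ≡ P w × u ≤ z × ¬ Φ z

    module Earliest = Bounds (λ a b → b ≤ a) (≤-refl _) (λ a≥b b≥c → ≤-trans _ _ _ b≥c a≥b)
                             Counterexample
                             (λ Qx Qy → swap (same-process-total (proj₁ Qx) (proj₁ Qy)))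

    ¬¬Φw : ¬ ¬ Φ w
    ¬¬Φw ¬Φw with Earliest.finite-upper-bound (downFinite w) (refl , u≤w , ¬Φw)
    ... | x , (px , u≤x , ¬Φx) , x≤w , earliest
      with proc-predecessor (trans pu≡pw (sym px)) (u≤x , λ u≡x → ¬Φx (subst Φ u≡x Φu))
    ... | y , u≤y , y⋖x@(py≡px , (y≤x , y≢x) , _) = ¬Φx (step y⋖x Φy)
      where
      Φy : Φ y
      Φy = decidable-stable em λ ¬Φy →
        y≢x (≤-antisym y x y≤x (earliest y (≤-trans y x w y≤x x≤w) (trans py≡px px , u≤y , ¬Φy)))

module Automaton {n : ℕ} (I : Fin n → Fin n → Bool) where

  pattern idle  = zero
  pattern final = suc zero

  permits : Label n → Bool
  permits (lab p q snd) = I p q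
  permits (lab p q rcv) = true

  forbidden-send : ∀ {p} (L : Label n) → proc L ≡ p → permits L ≡ false →
                   L ≡ lab p (partner L) snd × I p (partner L) ≡ false
  forbidden-send (lab p q snd) refl forbidden = refl , forbidden

  -- The third local state is never entered.
  transition : Fin n → Fin 3 → Fin n → Dir → Vec Bool 0 → Fin 1 → Fin 3 → Bool
  transition _ idle  _ _ _ _ idle  = true
  transition _ idle  _ _ _ _ final = true
  transition p final q d _ _ final = permits (lab p q d)
  transition _ _     _ _ _ _ _     = false

  from-final : ∀ p q d b m t → transition p final q d b m t ≡ true →
               t ≡ final × permits (lab p q d) ≡ true
  from-final p q d b m final permitted = refl , permitted

  all-final : ((p : Fin n) → Fin 3) → Bool
  all-final s = does (all? λ p → s p ≟ final)

  all-final⇒ : ∀ s → all-final s ≡ true → ∀ p → s p ≡ final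
  all-final⇒ s = does-true⇒ (all? λ p → s p ≟ final)

  all-final-const : all-final (λ _ → final) ≡ true
  all-final-const = dec-true (all? {n} λ _ → final ≟ final) λ _ → refl

  𝒜 : CFM n
  𝒜 = record { nMsg = 1 ; k = 0 ; nStates = λ _ → 3 ; init = λ _ → idle
             ; δ = transition ; F = all-final }

  index-one : HasIndex 𝒜 1
  index-one = product , λ { .zero (s≤s z≤n) (_ , F⇔) →
    ¬Fin0 (proj₁ (proj₁ (F⇔ (λ _ → final)) all-final-const)) }
    where
    product : UnionOfProducts 𝒜 1
    product = (λ _ _ t → does (t ≟ final)) , λ s →
      (λ Fs → zero , λ p → dec-true (s p ≟ final) (all-final⇒ s Fs p)) ,
      (λ { (_ , final-everywhere) → dec-true (all? λ p → s p ≟ final)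
                                       λ p → does-true⇒ (s p ≟ final) (final-everywhere p) })

module Correctness (em : ExcludedMiddle 0ℓ) {n : ℕ} (I : Fin n → Fin n → Bool) (M : MSC n) where
  open Automaton I
  open MSC M
  open IsMSC isMSC
  open ProcessOrder em M
  open Classical em {V}

  module _ {c : V → Vec Bool 0} (r : Run 𝒜 M c) where
    open Run r

    final-step : ∀ {y x} → ProcEdge pre y x → ρ y ≡ final → ρ x ≡ final × permits (lbl x) ≡ true
    final-step {y} {x} y⋖x ρy with stepProc y x y⋖x
    ... | moved rewrite subst-const (proj₁ y⋖x) (ρ y) | ρy =
      from-final (P x) (partner (lbl x)) (dir (lbl x)) (c x) (μ x) (ρ x) moved

    final-absorbing : ∀ {u w} → ρ u ≡ final → P u ≡ P w → u ≤ w → ρ w ≡ final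
    final-absorbing = proc-induction (λ z → ρ z ≡ final) (λ y⋖x → proj₁ ∘ final-step y⋖x)

    final-permits : ∀ {u w} → ρ u ≡ final → P u ≡ P w → u < w → permits (lbl w) ≡ true
    final-permits ρu pu≡pw u<w with proc-predecessor pu≡pw u<w
    ... | y , u≤y , y⋖w =
      proj₂ (final-step y⋖w (final-absorbing ρu (trans pu≡pw (sym (proj₁ y⋖w))) u≤y))

    accepting⇒InfSubset : AcceptingRun 𝒜 M c r → InfSubset M I
    accepting⇒InfSubset (s , Fs , recurring) p q _ infinite with I p q in I≡false
    ... | true  = refl
    ... | false = contradiction sends-finite infinite
      where
      Sends : V → Set
      Sends w = lbl w ≡ lab p q snd

      sends-finite : Finite Sends
      sends-finite with em {∃ Sends}
      ... | no ∄send = empty-finite λ v send → ∄send (v , send)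
      ... | yes (w₀ , send₀) with recurring p w₀ (cong proc send₀)
      ... | v′ , pv′ , _ , ρv′ = finite-⊆ (downFinite v′) below-v′
        where
        ρv′≡final : ρ v′ ≡ final
        ρv′≡final = trans (sym (subst-const pv′ (ρ v′))) (trans ρv′ (all-final⇒ s Fs p))

        below-v′ : ∀ v → Sends v → v ≤ v′
        below-v′ v send with same-process-total (cong proc send) pv′
        ... | inj₁ v≤v′ = v≤v′
        ... | inj₂ v′≤v with em {v′ ≡ v}
        ... | yes v′≡v = subst (_≤ v′) v′≡v (≤-refl v′)
        ... | no v′≢v = contradiction (trans (sym I-permits) I≡false) λ ()
          where
          I-permits : I p q ≡ true
          I-permits = trans (cong permits (sym send))
                        (final-permits ρv′≡final (trans pv′ (sym (cong proc send))) (v′≤v , v′≢v))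

  module _ (inf⊆I : InfSubset M I) where

    BadSend : Fin n → Fin n → V → Set
    BadSend p q w = lbl w ≡ lab p q snd × I p q ≡ false

    badSends-finite : ∀ p q → Finite (BadSend p q)
    badSends-finite p q with p ≟ q
    ... | yes refl = empty-finite λ w (send , _) →
                       lbl-valid w (trans (cong proc send) (sym (cong partner send)))
    ... | no p≢q with I p q in I≡
    ... | true  = empty-finite λ { w (_ , ()) }
    ... | false with em {Finite (λ w → lbl w ≡ lab p q snd)}
    ... | yes sends-finite = finite-⊆ sends-finite λ _ → proj₁
    ... | no infinite = contradiction (trans (sym I≡) (inf⊆I p q p≢q infinite)) λ ()

    Settled : V → Set
    Settled v = ∀ w → P w ≡ P v → v < w → permits (lbl w) ≡ true

    settled-step : ∀ {u v} → ProcEdge pre u v → Settled u → Settled v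
    settled-step (pu≡pv , u<v , _) settled-u w pw v<w =
      settled-u w (trans pw (sym pu≡pv)) (<-≤-trans u<v (proj₁ v<w))

    state : V → Fin 3
    state v = if does (em {Settled v}) then final else idle

    state-cases : ∀ v → (Settled v × state v ≡ final) ⊎ (¬ Settled v × state v ≡ idle)
    state-cases v with em {Settled v}
    ... | yes settled = inj₁ (settled , refl)
    ... | no unsettled = inj₂ (unsettled , refl)

    state-transition : ∀ {u v} → ProcEdge pre u v →
      transition (P v) (state u) (partner (lbl v)) (dir (lbl v)) [] zero (state v) ≡ true
    state-transition {u} {v} u⋖v@(pu≡pv , u<v , _) with state-cases u | state-cases v
    ... | inj₁ (settled-u , ρu) | inj₁ (_ , ρv) rewrite ρu | ρv = settled-u v (sym pu≡pv) u<v
    ... | inj₁ (settled-u , _)  | inj₂ (unsettled-v , _) =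
      contradiction (settled-step u⋖v settled-u) unsettled-v
    ... | inj₂ (_ , ρu) | inj₁ (_ , ρv) rewrite ρu | ρv = refl
    ... | inj₂ (_ , ρu) | inj₂ (_ , ρv) rewrite ρu | ρv = refl

    initial-transition : ∀ v →
      transition (P v) idle (partner (lbl v)) (dir (lbl v)) [] zero (state v) ≡ true
    initial-transition v with state-cases v
    ... | inj₁ (_ , ρv) rewrite ρv = refl
    ... | inj₂ (_ , ρv) rewrite ρv = refl

    run : Run 𝒜 M (λ _ → [])
    run = record
      { ρ        = state
      ; μ        = λ _ → zero
      ; msgOk    = λ _ _ _ → refl
      ; stepProc = λ u v u⋖v →
          subst (λ s → transition (P v) s (partner (lbl v)) (dir (lbl v)) [] zero (state v) ≡ true)
                (sym (subst-const (proj₁ u⋖v) (state u))) (state-transition u⋖v)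
      ; stepInit = λ v _ → initial-transition v
      }

    final-recurring : ∀ p → Recurring 𝒜 M state p final
    final-recurring p v pv with Latest.⋃-upper-bound (badSends-finite p) pv
      where
      module Latest = Bounds _≤_ (≤-refl _) (≤-trans _ _ _) (λ z → P z ≡ p) same-process-total
    ... | r , pr , v≤r , latest = r , pr , v≤r , trans (subst-const pr (state r)) state-r
      where
      settled : Settled r
      settled w pw (r≤w , r≢w) with permits (lbl w) in forbidden
      ... | true  = refl
      ... | false = contradiction (≤-antisym r w r≤w w≤r) r≢w
        where
        pw≡p : P w ≡ p
        pw≡p = trans pw pr
        w≤r : w ≤ r
        w≤r = latest w (partner (lbl w) , forbidden-send (lbl w) pw≡p forbidden) pw≡p

      state-r : state r ≡ final
      state-r with state-cases r
      ... | inj₁ (_ , ρr) = ρr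
      ... | inj₂ (unsettled , _) = contradiction settled unsettled

    InfSubset⇒accepts : Accepts 𝒜 M
    InfSubset⇒accepts = (λ _ → []) , run , (λ _ → final) , all-final-const , final-recurring

lemma3p4 : ExcludedMiddle 0ℓ → (n : ℕ) (I : Fin n → Fin n → Bool) →
    Σ (CFM n) λ A →
      CFM.k A ≡ 0 × HasIndex A 1 × (∀ p → CFM.nStates A p ≡ 3) × CFM.nMsg A ≡ 1 ×
      (∀ (M : MSC n) → Accepts A M ⟺ InfSubset M I)
lemma3p4 em n I = 𝒜 , refl , index-one , (λ _ → refl) , refl , λ M →
  (λ { (_ , r , accepting) → Correctness.accepting⇒InfSubset em I M r accepting }) ,
  Correctness.InfSubset⇒accepts em I M
  where open Automaton I
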